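{- Let $m\in\mathbb Z_{\ge1}$, $\overline l=(l_1,\ldots,l_m)\in\mathbb Z_{\ge1}^m$, $L=\sum_{j=1}^m l_j$, and $\overline\beta=(\beta_1,\ldots,\beta_m)\in(\mathbb C\setminus\{0\})^m$. Let $P(x)\in\mathbb C[x]$ be a polynomial of degree one with $P(k)\neq0$ for all $k\in\mathbb Z_{\ge0}$, put $[P]_n=\prod_{k=0}^{n-1}P(k)$ (so $[P]_0=1$) and $G(t)=\sum_{n=0}^\infty [P]_n t^n\in\mathbb C[[t]]$. Let $\mu\in\mathbb Z_{\ge0}$ and set $$A_{\overline l,\mu,0}(t)=\sum_{i=0}^L\frac{\sigma_i(\overline l,\overline\beta)}{[P]_{i+\mu}}\,t^{L-i}.$$ Then there exist polynomials $A_{\overline l,\mu,j}(t)$ and formal power series $R_{\overline l,\mu,j}(t)$, $j=1,\ldots,m$, such that $$A_{\overline l,\mu,0}(t)G(\beta_jt)-A_{\overline l,\mu,j}(t)=R_{\overline l,\mu,j}(t),$$ where $\deg A_{\overline l,\mu,0}(t)=L$, $\deg A_{\overline l,\mu,j}(t)\le L+\mu-1$, and $\operatorname{ord}_{t=0}R_{\overline l,\mu,j}(t)\ge L+\mu+l_j$.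
   Context: The numbers $\sigma_i=\sigma_i(\overline l,\overline\beta)$, $i=0,\ldots,L$, are defined by the polynomial identity $\prod_{j=1}^m(\beta_j-w)^{l_j}=\sum_{i=0}^L\sigma_iw^i$. -}

module Defs where

open import Level using (Level; _⊔_) renaming (suc to lsuc)
open import Data.Nat using (ℕ; zero; suc; _∸_; _≤?_)
open import Data.Fin using (Fin) renaming (zero to fzero; suc to fsuc)
open import Relation.Nullary using (¬_; yes; no)
open import Algebra.Bundles using (CommutativeRing)

record Field (c ℓ : Level) : Set (lsuc (c ⊔ ℓ)) where
  field
    commutativeRing : CommutativeRing c ℓ
  open CommutativeRing commutativeRing public
  field
    inv       : Carrier → Carrier
    inv-right : ∀ x → ¬ (x ≈ 0#) → x * inv x ≈ 1#
    0≉1       : ¬ (0# ≈ 1#)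

module Series {c ℓ : Level} (F : Field c ℓ) where
  open Field F public

  ι : ℕ → Carrier
  ι zero    = 0#
  ι (suc n) = 1# + ι n

  CharZero : Set ℓ
  CharZero = ∀ n → ¬ (ι (suc n) ≈ 0#)

  _^_ : Carrier → ℕ → Carrier
  x ^ zero  = 1#
  x ^ suc n = x * (x ^ n)

  -- formal power series (polynomials are those with finitely many nonzero coefficients),
  -- represented by their coefficient sequence
  Ser : Set c
  Ser = ℕ → Carrier

  sumBelow : ℕ → (ℕ → Carrier) → Carrier
  sumBelow zero    f = 0#
  sumBelow (suc n) f = sumBelow n f + f n

  prodBelow : ℕ → (ℕ → Carrier) → Carrier
  prodBelow zero    f = 1#
  prodBelow (suc n) f = prodBelow n f * f n

  _⊛_ : Ser → Ser → Ser
  (a ⊛ b) n = sumBelow (suc n) (λ k → a k * b (n ∸ k))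

  oneS : Ser
  oneS zero    = 1#
  oneS (suc _) = 0#

  _^S_ : Ser → ℕ → Ser
  s ^S zero  = oneS
  s ^S suc n = s ⊛ (s ^S n)

  linear : Carrier → Ser
  linear β zero          = β
  linear β (suc zero)    = - 1#
  linear β (suc (suc _)) = 0#

  prodFin : (m : ℕ) → (Fin m → Ser) → Ser
  prodFin zero    s = oneS
  prodFin (suc m) s = s fzero ⊛ prodFin m (λ j → s (fsuc j))

  sumFin : (m : ℕ) → (Fin m → ℕ) → ℕ
  sumFin zero    l = 0
  sumFin (suc m) l = l fzero Data.Nat.+ sumFin m (λ j → l (fsuc j))

  -- σ_i(l, β): coefficients of ∏_j (β_j - w)^{l_j} = Σ_i σ_i w^i
  σ : (m : ℕ) → (Fin m → ℕ) → (Fin m → Carrier) → ℕ → Carrier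
  σ m l β = prodFin m (λ j → linear (β j) ^S l j)

  Pval : Carrier → Carrier → ℕ → Carrier
  Pval a b k = a * ι k + b

  Ppoch : Carrier → Carrier → ℕ → Carrier
  Ppoch a b n = prodBelow n (Pval a b)

  Gβ : Carrier → Carrier → Carrier → Ser
  Gβ a b β n = Ppoch a b n * (β ^ n)

  -- A_{l,μ,0}(t) = Σ_{i=0}^{L} σ_i / [P]_{i+μ} t^{L-i};
  -- coefficient of t^n is σ_{L-n} / [P]_{L-n+μ} for n ≤ L, and 0 otherwise
  A0 : Carrier → Carrier → (m : ℕ) → (Fin m → ℕ) → (Fin m → Carrier) → ℕ → Ser
  A0 a b m l β μ n with n ≤? sumFin m l
  ... | yes _ = σ m l β (sumFin m l ∸ n) * inv (Ppoch a b ((sumFin m l ∸ n) Data.Nat.+ μ))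
  ... | no  _ = 0#

module Submission where

-- Write L = Σ_j l_j, c_j = A_{l,μ,0}(t) · G(β_j t), and take A_j to be the part of c_j
-- of degree < L + μ, R_j = c_j - A_j.  Everything then rests on one fact: the
-- coefficients of c_j of degree L + μ + N vanish for N < l_j.
--
-- Substituting i = L - k, that coefficient is Σ_{i ≤ L} σ_i β_j^i w(i) with
-- w(i) = β_j^(μ+N) ∏_{t<N} P(i+μ+t), because [P]_{i+μ+N} / [P]_{i+μ} = ∏_{t<N} P(i+μ+t).
-- As P has degree one, w is a polynomial sequence of degree N < l_j.  Degree is
-- measured by iterated forward differences, so no division is needed.
--
-- Call a series f annihilated at β to order l if Σ_i f_i β^i w(i) = 0 for every
-- polynomial sequence w of degree < l.  Multiplication by (β - X) raises this order by
-- one (summation by parts), and multiplication by any polynomial preserves it.  Hence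
-- ∏_k (β_k - X)^{l_k}, whose coefficients are the σ_i, is annihilated at β_j to
-- order l_j, which is the vanishing we need.

open import Defs
open import Level using (Level; _⊔_)
open import Data.Nat using (ℕ; zero; suc; _≤_; _<_; _∸_; _≤?_; _<?_; z≤n; s≤s) renaming (_+_ to _+ℕ_)
import Data.Nat.Properties as ℕP
open import Data.Sum using (inj₁; inj₂)
open import Data.Empty using (⊥-elim)
open import Data.Fin using (Fin) renaming (zero to fzero; suc to fsuc)
open import Data.Product using (Σ; _×_; _,_)
open import Relation.Nullary using (¬_; yes; no)
import Relation.Binary.PropositionalEquality as P

module Development {c ℓ : Level} (F : Field c ℓ) where
  open Series F
  open import Relation.Binary.Reasoning.Setoid setoid
  open import Algebra.Solver.Ring.NaturalCoefficients.Default commutativeSemiring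
  open import Algebra.Properties.AbelianGroup +-abelianGroup using (⁻¹-∙-comm; ⁻¹-anti-homo‿-)
  open import Algebra.Properties.Ring ring using (-‿distribˡ-*; x[y-z]≈xy-xz; -1*x≈-x)

  sum-cong : ∀ n {f g : ℕ → Carrier} → (∀ k → k < n → f k ≈ g k) → sumBelow n f ≈ sumBelow n g
  sum-cong zero    h = refl
  sum-cong (suc n) h = +-cong (sum-cong n (λ k k<n → h k (ℕP.m<n⇒m<1+n k<n))) (h n (ℕP.n<1+n n))

  sum-zero : ∀ n {f : ℕ → Carrier} → (∀ k → k < n → f k ≈ 0#) → sumBelow n f ≈ 0#
  sum-zero zero    h = refl
  sum-zero (suc n) h =
    trans (+-cong (sum-zero n (λ k k<n → h k (ℕP.m<n⇒m<1+n k<n))) (h n (ℕP.n<1+n n))) (+-identityˡ 0#)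

  sum-+ : ∀ n f g → sumBelow n (λ k → f k + g k) ≈ sumBelow n f + sumBelow n g
  sum-+ zero    f g = sym (+-identityˡ 0#)
  sum-+ (suc n) f g = trans (+-cong (sum-+ n f g) refl) (interchange _ _ _ _)
    where
    interchange : ∀ a b c d → (a + b) + (c + d) ≈ (a + c) + (b + d)
    interchange = solve 4 (λ a b c d → (a :+ b) :+ (c :+ d) := (a :+ c) :+ (b :+ d)) refl

  sum-*ˡ : ∀ n x f → sumBelow n (λ k → x * f k) ≈ x * sumBelow n f
  sum-*ˡ zero    x f = sym (zeroʳ x)
  sum-*ˡ (suc n) x f = trans (+-cong (sum-*ˡ n x f) refl) (sym (distribˡ x _ _))

  sum-*ʳ : ∀ n x f → sumBelow n (λ k → f k * x) ≈ sumBelow n f * x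
  sum-*ʳ zero    x f = sym (zeroˡ x)
  sum-*ʳ (suc n) x f = trans (+-cong (sum-*ʳ n x f) refl) (sym (distribʳ x _ _))

  sum-truncate : ∀ n m f → n ≤ m → (∀ k → n ≤ k → f k ≈ 0#) → sumBelow m f ≈ sumBelow n f
  sum-truncate zero zero f _ _ = refl
  sum-truncate n (suc m) f n≤1+m h with ℕP.m≤n⇒m<n∨m≡n n≤1+m
  ... | inj₁ n≤m   = trans (+-cong (sum-truncate n m f (ℕP.≤-pred n≤m) h) (h m (ℕP.≤-pred n≤m))) (+-identityʳ _)
  ... | inj₂ P.refl = refl

  sum-head : ∀ n f → sumBelow (suc n) f ≈ f 0 + sumBelow n (λ k → f (suc k))
  sum-head zero    f = +-comm 0# (f 0)
  sum-head (suc n) f = trans (+-cong (sum-head n f) refl) (+-assoc _ _ _)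

  sum-reverse : ∀ n f → sumBelow n f ≈ sumBelow n (λ i → f (n ∸ suc i))
  sum-reverse zero    f = refl
  sum-reverse (suc n) f =
    trans (+-comm _ _) (trans (+-cong refl (sum-reverse n f)) (sym (sum-head n (λ i → f (suc n ∸ suc i)))))

  -- Summing over the triangle {(k, j) : k + j < M} by diagonals or by rows.
  sum-triangle : ∀ M (h : ℕ → ℕ → Carrier) →
    sumBelow M (λ n → sumBelow (suc n) (λ k → h k (n ∸ k))) ≈ sumBelow M (λ k → sumBelow (M ∸ k) (h k))
  sum-triangle zero    h = refl
  sum-triangle (suc M) h = begin
      sumBelow M (λ n → sumBelow (suc n) (λ k → h k (n ∸ k))) + sumBelow (suc M) (λ k → h k (M ∸ k))
    ≈⟨ +-cong (trans (sum-triangle M h) (sym emptyLastRow)) refl ⟩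
      sumBelow (suc M) (λ k → sumBelow (M ∸ k) (h k)) + sumBelow (suc M) (λ k → h k (M ∸ k))
    ≈⟨ sym (sum-+ (suc M) _ _) ⟩
      sumBelow (suc M) (λ k → sumBelow (M ∸ k) (h k) + h k (M ∸ k))
    ≈⟨ sum-cong (suc M) (λ k k<1+M → reflexive (P.cong (λ t → sumBelow t (h k)) (P.sym (ℕP.+-∸-assoc 1 (ℕP.≤-pred k<1+M))))) ⟩
      sumBelow (suc M) (λ k → sumBelow (suc M ∸ k) (h k))
    ∎
    where
    emptyLastRow : sumBelow (suc M) (λ k → sumBelow (M ∸ k) (h k)) ≈ sumBelow M (λ k → sumBelow (M ∸ k) (h k))
    emptyLastRow = trans (+-cong refl (reflexive (P.cong (λ t → sumBelow t (h M)) (ℕP.n∸n≡0 M)))) (+-identityʳ _)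

  Supp : ℕ → Ser → Set ℓ
  Supp D f = ∀ n → D ≤ n → f n ≈ 0#

  supp-cong : ∀ D {f g : Ser} → (∀ n → f n ≈ g n) → Supp D f → Supp D g
  supp-cong D f≈g sf n D≤n = trans (sym (f≈g n)) (sf n D≤n)

  supp-one : Supp 1 oneS
  supp-one (suc n) _ = refl

  supp-linear : ∀ β → Supp 2 (linear β)
  supp-linear β (suc (suc n)) _         = refl
  supp-linear β (suc zero)    (s≤s ())

  ⊛-comm : ∀ f g n → (f ⊛ g) n ≈ (g ⊛ f) n
  ⊛-comm f g n = trans (sum-reverse (suc n) _) (sum-cong (suc n) swap)
    where
    swap : ∀ i → i < suc n → f (n ∸ i) * g (n ∸ (n ∸ i)) ≈ g i * f (n ∸ i)
    swap i i<1+n = trans (*-comm _ _) (*-cong (reflexive (P.cong g (ℕP.m∸[m∸n]≡n (ℕP.≤-pred i<1+n)))) refl)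

  ⊛-vanishes : ∀ E D f g → Supp E f → Supp D g → ∀ n → (∀ k → k < E → k +ℕ D ≤ n) → (f ⊛ g) n ≈ 0#
  ⊛-vanishes E D f g sf sg n far = sum-zero (suc n) (λ k _ → term k)
    where
    term : ∀ k → f k * g (n ∸ k) ≈ 0#
    term k with E ≤? k
    ... | yes E≤k = trans (*-cong (sf k E≤k) refl) (zeroˡ _)
    ... | no  E≰k = trans (*-cong refl (sg (n ∸ k) D≤n-k)) (zeroʳ _)
      where
      D≤n-k : D ≤ n ∸ k
      D≤n-k = P.subst (_≤ n ∸ k) (ℕP.m+n∸m≡n k D) (ℕP.∸-monoˡ-≤ k (far k (ℕP.≰⇒> E≰k)))

  supp-⊛ : ∀ E D f g → Supp E f → Supp D g → Supp (E +ℕ D) (f ⊛ g)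
  supp-⊛ E D f g sf sg n E+D≤n =
    ⊛-vanishes E D f g sf sg n (λ k k<E → ℕP.≤-trans (ℕP.+-monoˡ-≤ D (ℕP.<⇒≤ k<E)) E+D≤n)

  degree-⊛ : ∀ d e f g → Supp (suc d) f → Supp (suc e) g → Supp (suc (d +ℕ e)) (f ⊛ g)
  degree-⊛ d e f g sf sg n d+e<n = ⊛-vanishes (suc d) (suc e) f g sf sg n
    (λ k k≤d → ℕP.≤-trans (ℕP.+-monoˡ-≤ (suc e) (ℕP.≤-pred k≤d)) (P.subst (_≤ n) (P.sym (ℕP.+-suc d e)) d+e<n))

  sum-⊛ : ∀ E D f g (W : ℕ → Carrier) → Supp E f → Supp D g →
    sumBelow (E +ℕ D) (λ n → (f ⊛ g) n * W n) ≈ sumBelow E (λ k → sumBelow D (λ j → (f k * g j) * W (k +ℕ j)))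
  sum-⊛ E D f g W sf sg = begin
      sumBelow M (λ n → (f ⊛ g) n * W n)
    ≈⟨ sum-cong M (λ n _ → trans (sym (sum-*ʳ (suc n) (W n) _)) (sum-cong (suc n) (λ k k<1+n →
         *-cong refl (reflexive (P.cong W (P.sym (ℕP.m+[n∸m]≡n (ℕP.≤-pred k<1+n)))))))) ⟩
      sumBelow M (λ n → sumBelow (suc n) (λ k → h k (n ∸ k)))
    ≈⟨ sum-triangle M h ⟩
      sumBelow M (λ k → sumBelow (M ∸ k) (h k))
    ≈⟨ sum-cong M (λ k _ → row k) ⟩
      sumBelow M (λ k → sumBelow D (h k))
    ≈⟨ sum-truncate E M _ (ℕP.m≤m+n E D) (λ k E≤k → sum-zero D (λ j _ → h-left k E≤k j)) ⟩
      sumBelow E (λ k → sumBelow D (h k)) ∎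
    where
    M : ℕ
    M = E +ℕ D
    h : ℕ → ℕ → Carrier
    h k j = (f k * g j) * W (k +ℕ j)
    h-left : ∀ k → E ≤ k → ∀ j → h k j ≈ 0#
    h-left k E≤k j = trans (*-cong (trans (*-cong (sf k E≤k) refl) (zeroˡ _)) refl) (zeroˡ _)
    h-right : ∀ k j → D ≤ j → h k j ≈ 0#
    h-right k j D≤j = trans (*-cong (trans (*-cong refl (sg j D≤j)) (zeroʳ _)) refl) (zeroˡ _)
    -- each row k < E is a sum over D + (E - k) ≥ D indices, of which only the first D count
    row : ∀ k → sumBelow (M ∸ k) (h k) ≈ sumBelow D (h k)
    row k with E ≤? k
    ... | yes E≤k = trans (sum-zero (M ∸ k) (λ j _ → h-left k E≤k j)) (sym (sum-zero D (λ j _ → h-left k E≤k j)))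
    ... | no  E≰k = P.subst (λ t → sumBelow t (h k) ≈ sumBelow D (h k)) (P.sym rowLength)
                      (sum-truncate D (D +ℕ (E ∸ k)) (h k) (ℕP.m≤m+n D _) (h-right k))
      where
      rowLength : M ∸ k P.≡ D +ℕ (E ∸ k)
      rowLength = P.trans (ℕP.+-∸-comm D (ℕP.<⇒≤ (ℕP.≰⇒> E≰k))) (ℕP.+-comm (E ∸ k) D)

  -- Polynomial sequences via finite differences

  Δ : (ℕ → Carrier) → ℕ → Carrier
  Δ w i = w (suc i) - w i

  -- DegBelow d w: the d-th difference of w vanishes, i.e. w is a polynomial in i of degree < d.
  DegBelow : ℕ → (ℕ → Carrier) → Set ℓ
  DegBelow zero    w = ∀ i → w i ≈ 0#
  DegBelow (suc d) w = DegBelow d (Δ w)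

  0-0≈0 : 0# - 0# ≈ 0#
  0-0≈0 = -‿inverseʳ 0#

  degBelow-cong : ∀ d {u v : ℕ → Carrier} → (∀ i → u i ≈ v i) → DegBelow d u → DegBelow d v
  degBelow-cong zero    u≈v du i = trans (sym (u≈v i)) (du i)
  degBelow-cong (suc d) u≈v du = degBelow-cong d (λ i → +-cong (u≈v (suc i)) (-‿cong (u≈v i))) du

  degBelow-+ : ∀ d {u v : ℕ → Carrier} → DegBelow d u → DegBelow d v → DegBelow d (λ i → u i + v i)
  degBelow-+ zero    du dv i = trans (+-cong (du i) (dv i)) (+-identityˡ 0#)
  degBelow-+ (suc d) du dv = degBelow-cong d (λ i → Δ-+ _ _ _ _) (degBelow-+ d du dv)
    where
    Δ-+ : ∀ a b c e → (a - b) + (c - e) ≈ (a + c) - (b + e)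
    Δ-+ a b c e = trans (interchange a c (- b) (- e)) (+-cong refl (⁻¹-∙-comm b e))
      where
      interchange : ∀ a c nb ne → (a + nb) + (c + ne) ≈ (a + c) + (nb + ne)
      interchange = solve 4 (λ a c nb ne → (a :+ nb) :+ (c :+ ne) := (a :+ c) :+ (nb :+ ne)) refl

  degBelow-scale : ∀ d x {u : ℕ → Carrier} → DegBelow d u → DegBelow d (λ i → x * u i)
  degBelow-scale zero    x du i = trans (*-cong refl (du i)) (zeroʳ x)
  degBelow-scale (suc d) x du = degBelow-cong d (λ i → x[y-z]≈xy-xz x _ _) (degBelow-scale d x du)

  degBelow-suc : ∀ d {u : ℕ → Carrier} → DegBelow d u → DegBelow (suc d) u
  degBelow-suc zero    du i = trans (+-cong (du (suc i)) (-‿cong (du i))) 0-0≈0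
  degBelow-suc (suc d) du = degBelow-suc d du

  degBelow-mono : ∀ d e {u : ℕ → Carrier} → d ≤ e → DegBelow d u → DegBelow e u
  degBelow-mono _ zero z≤n du = du
  degBelow-mono d (suc e) d≤1+e du with ℕP.m≤n⇒m<n∨m≡n d≤1+e
  ... | inj₁ d≤e    = degBelow-suc e (degBelow-mono d e (ℕP.≤-pred d≤e) du)
  ... | inj₂ P.refl = du

  degBelow-shift : ∀ d s {u : ℕ → Carrier} → DegBelow d u → DegBelow d (λ i → u (s +ℕ i))
  degBelow-shift zero    s du i = du (s +ℕ i)
  degBelow-shift (suc d) s {u} du =
    degBelow-cong d (λ i → +-cong (reflexive (P.cong u (P.sym (ℕP.+-suc s i)))) refl) (degBelow-shift d s du)

  degBelow-const : ∀ x → DegBelow 1 (λ _ → x)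
  degBelow-const x i = -‿inverseʳ x

  -- Multiplying by a sequence with constant increment a (a linear function) raises the degree by one:
  -- Δ(u v)(i) = Δu(i) v(i) + a u(i+1).
  degBelow-*linear : ∀ a d {u v : ℕ → Carrier} → (∀ i → v (suc i) ≈ v i + a) →
                     DegBelow d u → DegBelow (suc d) (λ i → u i * v i)
  degBelow-*linear a zero {u} {v} _ du i =
    trans (+-cong (trans (*-cong (du (suc i)) refl) (zeroˡ _)) (-‿cong (trans (*-cong (du i) refl) (zeroˡ _)))) 0-0≈0
  degBelow-*linear a (suc d) {u} {v} hv du =
    degBelow-cong (suc d) (λ i → sym (leibniz i))
      (degBelow-+ (suc d) (degBelow-*linear a d hv du) (degBelow-scale (suc d) a (degBelow-shift (suc d) 1 du)))
    where
    leibniz : ∀ i → u (suc i) * v (suc i) - u i * v i ≈ (u (suc i) - u i) * v i + a * u (suc i)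
    leibniz i = begin
        u (suc i) * v (suc i) - u i * v i
      ≈⟨ +-cong (*-cong refl (hv i)) (-‿distribˡ-* _ _) ⟩
        u (suc i) * (v i + a) + (- u i) * v i
      ≈⟨ solve 4 (λ us nui vi a → us :* (vi :+ a) :+ nui :* vi := (us :* vi :+ nui :* vi) :+ a :* us) refl
               (u (suc i)) (- u i) (v i) a ⟩
        (u (suc i) * v i + (- u i) * v i) + a * u (suc i)
      ≈⟨ +-cong (sym (distribʳ _ _ _)) refl ⟩
        (u (suc i) - u i) * v i + a * u (suc i) ∎

  -- Annihilation at a point

  pow-+ : ∀ x m n → x ^ (m +ℕ n) ≈ x ^ m * x ^ n
  pow-+ x zero    n = sym (*-identityˡ _)
  pow-+ x (suc m) n = trans (*-cong refl (pow-+ x m n)) (sym (*-assoc _ _ _))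

  moment : Carrier → ℕ → Ser → (ℕ → Carrier) → Carrier
  moment β D f w = sumBelow D (λ i → f i * (β ^ i * w i))

  moment-bound : ∀ β D D' f w → Supp D f → Supp D' f → moment β D f w ≈ moment β D' f w
  moment-bound β D D' f w sD sD' =
    trans (sym (sum-truncate D (D +ℕ D') _ (ℕP.m≤m+n D D') (dead sD)))
          (P.subst (λ t → moment β t f w ≈ moment β D' f w) (ℕP.+-comm D' D)
                   (sum-truncate D' (D' +ℕ D) _ (ℕP.m≤m+n D' D) (dead sD')))
    where
    dead : ∀ {B} → Supp B f → ∀ k → B ≤ k → f k * (β ^ k * w k) ≈ 0#
    dead sB k B≤k = trans (*-cong (sB k B≤k) refl) (zeroˡ _)

  -- f is annihilated at β to order l: all moments against polynomials of degree < l vanish.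
  -- For a polynomial f this says that β is a root of f of multiplicity ≥ l.
  Annihilated : Carrier → ℕ → Ser → Set (c ⊔ ℓ)
  Annihilated β l f = ∀ D → Supp D f → ∀ (w : ℕ → Carrier) → DegBelow l w → moment β D f w ≈ 0#

  annihilated-zero : ∀ β f → Annihilated β 0 f
  annihilated-zero β f D _ w dw =
    sum-zero D (λ i _ → trans (*-cong refl (trans (*-cong refl (dw i)) (zeroʳ _))) (zeroʳ _))

  annihilated-cong : ∀ β l {f g : Ser} → (∀ n → f n ≈ g n) → Annihilated β l f → Annihilated β l g
  annihilated-cong β l f≈g af D sD w dw =
    trans (sum-cong D (λ i _ → *-cong (sym (f≈g i)) refl)) (af D (supp-cong D (λ n → sym (f≈g n)) sD) w dw)

  -- Multiplying by a polynomial f preserves annihilation: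
  -- moment (f ⊛ g) w = Σ_k f_k β^k · moment g (w shifted by k).
  annihilated-⊛ˡ : ∀ β l E D f g → Supp E f → Supp D g → Annihilated β l g → Annihilated β l (f ⊛ g)
  annihilated-⊛ˡ β l E D f g sf sg ag B sB w dw = begin
      moment β B (f ⊛ g) w
    ≈⟨ moment-bound β B (E +ℕ D) (f ⊛ g) w sB (supp-⊛ E D f g sf sg) ⟩
      moment β (E +ℕ D) (f ⊛ g) w
    ≈⟨ sum-⊛ E D f g (λ n → β ^ n * w n) sf sg ⟩
      sumBelow E (λ k → sumBelow D (λ j → (f k * g j) * (β ^ (k +ℕ j) * w (k +ℕ j))))
    ≈⟨ sum-cong E (λ k _ → trans (sum-cong D (λ j _ → regroup k j)) (sum-*ˡ D (f k * β ^ k) _)) ⟩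
      sumBelow E (λ k → (f k * β ^ k) * moment β D g (λ j → w (k +ℕ j)))
    ≈⟨ sum-zero E (λ k _ → trans (*-cong refl (ag D sg _ (degBelow-shift l k dw))) (zeroʳ _)) ⟩
      0# ∎
    where
    regroup : ∀ k j → (f k * g j) * (β ^ (k +ℕ j) * w (k +ℕ j)) ≈ (f k * β ^ k) * (g j * (β ^ j * w (k +ℕ j)))
    regroup k j = trans (*-cong refl (*-cong (pow-+ β k j) refl))
      (solve 5 (λ a b c d e → (a :* b) :* ((c :* d) :* e) := (a :* c) :* (b :* (d :* e))) refl
             (f k) (g j) (β ^ k) (β ^ j) (w (k +ℕ j)))

  annihilated-⊛ʳ : ∀ β l E D f g → Supp E f → Supp D g → Annihilated β l f → Annihilated β l (f ⊛ g)
  annihilated-⊛ʳ β l E D f g sf sg af =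
    annihilated-cong β l (⊛-comm g f) (annihilated-⊛ˡ β l D E g f sg sf af)

  -- Multiplying by (β - X) raises the order by one (summation by parts):
  -- moment ((β - X) ⊛ h) w = - β · moment h (Δ w).
  annihilated-linear : ∀ β l E h → Supp E h → Annihilated β l h → Annihilated β (suc l) (linear β ⊛ h)
  annihilated-linear β l E h sh ah B sB w dw = begin
      moment β B (linear β ⊛ h) w
    ≈⟨ moment-bound β B (2 +ℕ E) _ w sB (supp-⊛ 2 E (linear β) h (supp-linear β) sh) ⟩
      moment β (2 +ℕ E) (linear β ⊛ h) w
    ≈⟨ sum-⊛ 2 E (linear β) h (λ n → β ^ n * w n) (supp-linear β) sh ⟩
      (0# + sumBelow E constantPart) + sumBelow E linearPart
    ≈⟨ trans (+-cong (+-identityˡ _) refl) (sym (sum-+ E constantPart linearPart)) ⟩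
      sumBelow E (λ j → constantPart j + linearPart j)
    ≈⟨ sum-cong E (λ j _ → byParts j) ⟩
      sumBelow E (λ j → (- β) * (h j * (β ^ j * Δ w j)))
    ≈⟨ sum-*ˡ E (- β) _ ⟩
      (- β) * moment β E h (Δ w)
    ≈⟨ trans (*-cong refl (ah E sh (Δ w) dw)) (zeroʳ _) ⟩
      0# ∎
    where
    constantPart linearPart : ℕ → Carrier
    constantPart j = (β * h j) * (β ^ j * w j)
    linearPart   j = (- 1# * h j) * ((β * β ^ j) * w (suc j))
    byParts : ∀ j → constantPart j + linearPart j ≈ (- β) * (h j * (β ^ j * Δ w j))
    byParts j = sym (begin
        (- β) * (h j * (β ^ j * (w (suc j) - w j)))
      ≈⟨ sym (-‿distribˡ-* _ _) ⟩
        - (β * (h j * (β ^ j * (w (suc j) - w j))))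
      ≈⟨ -‿cong (trans (*-cong refl (trans (*-cong refl (x[y-z]≈xy-xz _ _ _)) (x[y-z]≈xy-xz _ _ _))) (x[y-z]≈xy-xz _ _ _)) ⟩
        - (β * (h j * (β ^ j * w (suc j))) - β * (h j * (β ^ j * w j)))
      ≈⟨ ⁻¹-anti-homo‿- _ _ ⟩
        β * (h j * (β ^ j * w j)) - β * (h j * (β ^ j * w (suc j)))
      ≈⟨ +-cong (reassoc β (h j) (β ^ j) (w j)) (-‿cong (shuffle β (h j) (β ^ j) (w (suc j)))) ⟩
        constantPart j + - (h j * ((β * β ^ j) * w (suc j)))
      ≈⟨ +-cong refl (trans (-‿distribˡ-* _ _) (*-cong (sym (-1*x≈-x (h j))) refl)) ⟩
        constantPart j + linearPart j ∎)
      where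
      reassoc : ∀ b x y z → b * (x * (y * z)) ≈ (b * x) * (y * z)
      reassoc = solve 4 (λ b x y z → b :* (x :* (y :* z)) := (b :* x) :* (y :* z)) refl
      shuffle : ∀ b x y z → b * (x * (y * z)) ≈ x * ((b * y) * z)
      shuffle = solve 4 (λ b x y z → b :* (x :* (y :* z)) := x :* ((b :* y) :* z)) refl

  supp-linear-pow : ∀ β l → Supp (suc l) (linear β ^S l)
  supp-linear-pow β zero    = supp-one
  supp-linear-pow β (suc l) = degree-⊛ 1 l (linear β) _ (supp-linear β) (supp-linear-pow β l)

  annihilated-linear-pow : ∀ β l → Annihilated β l (linear β ^S l)
  annihilated-linear-pow β zero    = annihilated-zero β _
  annihilated-linear-pow β (suc l) =
    annihilated-linear β l (suc l) _ (supp-linear-pow β l) (annihilated-linear-pow β l)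

  supp-σ : ∀ m (l : Fin m → ℕ) β → Supp (suc (sumFin m l)) (σ m l β)
  supp-σ zero    l β = supp-one
  supp-σ (suc m) l β = degree-⊛ (l fzero) (sumFin m (λ j → l (fsuc j))) _ _
    (supp-linear-pow (β fzero) (l fzero)) (supp-σ m (λ j → l (fsuc j)) (λ j → β (fsuc j)))

  annihilated-σ : ∀ m (l : Fin m → ℕ) β (j : Fin m) → Annihilated (β j) (l j) (σ m l β)
  annihilated-σ (suc m) l β fzero = annihilated-⊛ʳ (β fzero) (l fzero) _ _ _ _
    (supp-linear-pow (β fzero) (l fzero)) (supp-σ m (λ j → l (fsuc j)) (λ j → β (fsuc j)))
    (annihilated-linear-pow (β fzero) (l fzero))
  annihilated-σ (suc m) l β (fsuc j) = annihilated-⊛ˡ (β (fsuc j)) (l (fsuc j)) _ _ _ _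
    (supp-linear-pow (β fzero) (l fzero)) (supp-σ m (λ j → l (fsuc j)) (λ j → β (fsuc j)))
    (annihilated-σ m (λ j → l (fsuc j)) (λ j → β (fsuc j)) j)

  1≉0 : ¬ 1# ≈ 0#
  1≉0 1≈0 = 0≉1 (sym 1≈0)

  *-nonzero : ∀ x y → ¬ x ≈ 0# → ¬ y ≈ 0# → ¬ (x * y) ≈ 0#
  *-nonzero x y x≉0 y≉0 xy≈0 = y≉0 (begin
      y                ≈⟨ sym (*-identityˡ y) ⟩
      1# * y           ≈⟨ *-cong (sym (trans (*-comm _ _) (inv-right x x≉0))) refl ⟩
      (inv x * x) * y  ≈⟨ *-assoc _ _ _ ⟩
      inv x * (x * y)  ≈⟨ *-cong refl xy≈0 ⟩
      inv x * 0#       ≈⟨ zeroʳ _ ⟩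
      0#               ∎)

  inv-nonzero : ∀ x → ¬ x ≈ 0# → ¬ inv x ≈ 0#
  inv-nonzero x x≉0 inv≈0 = 1≉0 (trans (sym (inv-right x x≉0)) (trans (*-cong refl inv≈0) (zeroʳ x)))

  linear-pow-head≉0 : ∀ β → ¬ β ≈ 0# → ∀ l → ¬ (linear β ^S l) 0 ≈ 0#
  linear-pow-head≉0 β β≉0 zero    = 1≉0
  linear-pow-head≉0 β β≉0 (suc l) e =
    *-nonzero β _ β≉0 (linear-pow-head≉0 β β≉0 l) (trans (sym (+-identityˡ _)) e)

  σ-head≉0 : ∀ m (l : Fin m → ℕ) β → (∀ j → ¬ β j ≈ 0#) → ¬ σ m l β 0 ≈ 0#
  σ-head≉0 zero    l β _  = 1≉0
  σ-head≉0 (suc m) l β β≉0 e = *-nonzero _ _ (linear-pow-head≉0 (β fzero) (β≉0 fzero) (l fzero))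
    (σ-head≉0 m (λ j → l (fsuc j)) (λ j → β (fsuc j)) (λ j → β≉0 (fsuc j))) (trans (sym (+-identityˡ _)) e)

  prodBelow-split : ∀ m N (f : ℕ → Carrier) → prodBelow (m +ℕ N) f ≈ prodBelow m f * prodBelow N (λ t → f (m +ℕ t))
  prodBelow-split m zero f =
    P.subst (λ t → prodBelow t f ≈ prodBelow m f * 1#) (P.sym (ℕP.+-identityʳ m)) (sym (*-identityʳ _))
  prodBelow-split m (suc N) f =
    P.subst (λ t → prodBelow t f ≈ prodBelow m f * prodBelow (suc N) (λ t → f (m +ℕ t))) (P.sym (ℕP.+-suc m N))
      (trans (*-cong (prodBelow-split m N f) refl) (*-assoc _ _ _))

  truncate : ℕ → Ser → Ser
  truncate B s n with n <? B
  ... | yes _ = s n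
  ... | no  _ = 0#

  truncate-below : ∀ B s n → n < B → truncate B s n ≈ s n
  truncate-below B s n n<B with n <? B
  ... | yes _   = refl
  ... | no  n≮B = ⊥-elim (n≮B n<B)

  truncate-above : ∀ B s n → B ≤ n → truncate B s n ≈ 0#
  truncate-above B s n B≤n with n <? B
  ... | yes n<B = ⊥-elim (ℕP.<⇒≱ n<B B≤n)
  ... | no  _   = refl

  module Coefficients (a b : Carrier) (P≉0 : ∀ k → ¬ Pval a b k ≈ 0#) (μ m : ℕ) (l : Fin m → ℕ)
                      (β : Fin m → Carrier) (β≉0 : ∀ j → ¬ β j ≈ 0#) where
    L : ℕ
    L = sumFin m l

    A : Ser
    A = A0 a b m l β μ

    product : Fin m → Ser
    product j = A ⊛ Gβ a b (β j)

    Ppoch≉0 : ∀ n → ¬ Ppoch a b n ≈ 0#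
    Ppoch≉0 zero    = 1≉0
    Ppoch≉0 (suc n) = *-nonzero _ _ (Ppoch≉0 n) (P≉0 n)

    A-within : ∀ k → k ≤ L → A k ≈ σ m l β (L ∸ k) * inv (Ppoch a b ((L ∸ k) +ℕ μ))
    A-within k k≤L with k ≤? sumFin m l
    ... | yes _   = refl
    ... | no  k≰L = ⊥-elim (k≰L k≤L)

    A-beyond : ∀ k → L < k → A k ≈ 0#
    A-beyond k L<k with k ≤? sumFin m l
    ... | yes k≤L = ⊥-elim (ℕP.<⇒≱ L<k k≤L)
    ... | no  _   = refl

    A-leading≉0 : ¬ A L ≈ 0#
    A-leading≉0 e = *-nonzero _ _ (σ-head≉0 m l β β≉0) (inv-nonzero _ (Ppoch≉0 μ))
      (trans (sym (trans (A-within L ℕP.≤-refl)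
                         (reflexive (P.cong (λ t → σ m l β t * inv (Ppoch a b (t +ℕ μ))) (ℕP.n∸n≡0 L))))) e)

    -- [P]_{i+μ+N} / [P]_{i+μ} = ∏_{t<N} P(i+μ+t), a polynomial of degree N in i.
    quotient : ℕ → ℕ → Carrier
    quotient N i = prodBelow N (λ t → Pval a b ((i +ℕ μ) +ℕ t))

    quotient-degree : ∀ N → DegBelow (suc N) (quotient N)
    quotient-degree zero    = degBelow-const 1#
    quotient-degree (suc N) = degBelow-*linear a (suc N) (λ i → step a (ι ((i +ℕ μ) +ℕ N)) b) (quotient-degree N)
      where
      step : ∀ a t x → a * (1# + t) + x ≈ (a * t + x) + a
      step = solve 3 (λ a t x → a :* (con 1 :+ t) :+ x := (a :* t :+ x) :+ a) refl

    weight : Fin m → ℕ → ℕ → Carrier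
    weight j N i = β j ^ (μ +ℕ N) * quotient N i

    product-moment : ∀ j N → product j ((L +ℕ μ) +ℕ N) ≈ moment (β j) (suc L) (σ m l β) (weight j N)
    product-moment j N = begin
        sumBelow (suc n) (λ k → A k * G (n ∸ k))
      ≈⟨ sum-truncate (suc L) (suc n) _ (s≤s L≤n) (λ k L<k → trans (*-cong (A-beyond k L<k) refl) (zeroˡ _)) ⟩
        sumBelow (suc L) (λ k → A k * G (n ∸ k))
      ≈⟨ sum-reverse (suc L) _ ⟩
        sumBelow (suc L) (λ i → A (L ∸ i) * G (n ∸ (L ∸ i)))
      ≈⟨ sum-cong (suc L) (λ i i<1+L → term i (ℕP.≤-pred i<1+L)) ⟩
        moment (β j) (suc L) (σ m l β) (weight j N) ∎
      where
      n : ℕ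
      n = (L +ℕ μ) +ℕ N
      G : ℕ → Carrier
      G = Gβ a b (β j)
      L≤n : L ≤ n
      L≤n = ℕP.≤-trans (ℕP.m≤m+n L μ) (ℕP.m≤m+n (L +ℕ μ) N)
      term : ∀ i → i ≤ L → A (L ∸ i) * G (n ∸ (L ∸ i)) ≈ σ m l β i * (β j ^ i * weight j N i)
      term i i≤L = begin
          A (L ∸ i) * G (n ∸ (L ∸ i))
        ≈⟨ *-cong (trans (A-within (L ∸ i) (ℕP.m∸n≤m L i)) (reflexive (P.cong (λ t → s t * inv (Pp (t +ℕ μ))) L-[L-i])))
                  (reflexive (P.cong G exponent)) ⟩
          (s i * inv (Pp (i +ℕ μ))) * (Pp ((i +ℕ μ) +ℕ N) * β j ^ ((i +ℕ μ) +ℕ N))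
        ≈⟨ *-cong refl (*-cong (prodBelow-split (i +ℕ μ) N (Pval a b))
                               (trans (reflexive (P.cong (β j ^_) (ℕP.+-assoc i μ N))) (pow-+ (β j) i (μ +ℕ N)))) ⟩
          (s i * inv (Pp (i +ℕ μ))) * ((Pp (i +ℕ μ) * quotient N i) * (β j ^ i * β j ^ (μ +ℕ N)))
        ≈⟨ solve 6 (λ s ip p q bi bm → (s :* ip) :* ((p :* q) :* (bi :* bm)) := (p :* ip) :* (s :* (bi :* (bm :* q)))) refl
                 _ _ _ _ _ _ ⟩
          (Pp (i +ℕ μ) * inv (Pp (i +ℕ μ))) * (s i * (β j ^ i * weight j N i))
        ≈⟨ trans (*-cong (inv-right _ (Ppoch≉0 (i +ℕ μ))) refl) (*-identityˡ _) ⟩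
          s i * (β j ^ i * weight j N i) ∎
        where
        s : Ser
        s = σ m l β
        Pp : ℕ → Carrier
        Pp = Ppoch a b
        L-[L-i] : L ∸ (L ∸ i) P.≡ i
        L-[L-i] = ℕP.m∸[m∸n]≡n i≤L
        exponent : n ∸ (L ∸ i) P.≡ (i +ℕ μ) +ℕ N
        exponent = P.trans (P.cong (_∸ (L ∸ i)) (ℕP.+-assoc L μ N))
                   (P.trans (ℕP.+-∸-comm (μ +ℕ N) (ℕP.m∸n≤m L i))
                   (P.trans (P.cong (_+ℕ (μ +ℕ N)) L-[L-i]) (P.sym (ℕP.+-assoc i μ N))))

    product-gap : ∀ j N → N < l j → product j ((L +ℕ μ) +ℕ N) ≈ 0#
    product-gap j N N<l = trans (product-moment j N)
      (annihilated-σ m l β j (suc L) (supp-σ m l β) (weight j N)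
        (degBelow-scale (l j) _ (degBelow-mono (suc N) (l j) N<l (quotient-degree N))))

    remainder-order : ∀ j n → n < L +ℕ μ +ℕ l j → product j n - truncate (L +ℕ μ) (product j) n ≈ 0#
    remainder-order j n n<L+μ+l with ℕP.<-≤-connex n (L +ℕ μ)
    ... | inj₁ n<L+μ = trans (+-cong refl (-‿cong (truncate-below _ _ n n<L+μ))) (-‿inverseʳ _)
    ... | inj₂ L+μ≤n = trans (+-cong inGap (-‿cong (truncate-above _ _ n L+μ≤n))) 0-0≈0
      where
      split : (L +ℕ μ) +ℕ (n ∸ (L +ℕ μ)) P.≡ n
      split = ℕP.m+[n∸m]≡n L+μ≤n
      inGap : product j n ≈ 0#
      inGap = P.subst (λ t → product j t ≈ 0#) split (product-gap j _
        (ℕP.+-cancelˡ-< (L +ℕ μ) _ _ (P.subst (_< (L +ℕ μ) +ℕ l j) (P.sym split) n<L+μ+l)))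

theorem3 : {c ℓ : Level} (F : Field c ℓ) → let open Series F in
    CharZero →
    (m : ℕ) → 1 ≤ m →
    (l : Fin m → ℕ) → (∀ j → 1 ≤ l j) →
    (β : Fin m → Carrier) → (∀ j → ¬ (β j ≈ 0#)) →
    (a b : Carrier) → ¬ (a ≈ 0#) → (∀ k → ¬ (Pval a b k ≈ 0#)) →
    (μ : ℕ) →
    (¬ (A0 a b m l β μ (sumFin m l) ≈ 0#)
    × (∀ n → sumFin m l < n → A0 a b m l β μ n ≈ 0#))
    × (∀ (j : Fin m) → Σ Ser λ Aj → Σ Ser λ Rj →
    (∀ n → ((A0 a b m l β μ ⊛ Gβ a b (β j)) n - Aj n) ≈ Rj n)
    × (∀ n → sumFin m l +ℕ μ ≤ n → Aj n ≈ 0#)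
    × (∀ n → n < sumFin m l +ℕ μ +ℕ l j → Rj n ≈ 0#))
theorem3 F _ m _ l _ β β≉0 a b _ P≉0 μ =
  (A-leading≉0 , A-beyond) ,
  λ j → truncate (L +ℕ μ) (product j) ,
        (λ n → product j n - truncate (L +ℕ μ) (product j) n) ,
        (λ n → refl) ,
        (λ n → truncate-above (L +ℕ μ) (product j) n) ,
        remainder-order j
  where
  open Series F
  open Development F
  open Coefficients a b P≉0 μ m l β β≉0
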